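{- Let $l:K\to L$ be a morphism of graphs and $m:L\to G$ a matching of graphs (a monomorphism), regarded as an inclusion, so that $G=(L+\overline{L})+_e\widetilde{L}$ as in the decomposition described in the context, with $m$ the canonical inclusion. Let $l_1=l+\mathrm{id}_{|\overline{L}|}:|K|+|\overline{L}|\to|L|+|\overline{L}|$ on nodes. Let $\widetilde{K}$ be the graph made of one edge $(e,n,p):n\to p$ for each pair of nodes $n,p\in|K|+|\overline{L}|$ and each edge $e:l_1(n)\to l_1(p)$ of $\widetilde{L}$, and let $\widetilde{l}:\widetilde{K}\to\widetilde{L}$ map $(e,n,p)$ to $e$. Put $D=(K+\overline{L})+_e\widetilde{K}$, let $d:K\to D$ be the canonical inclusion and $l_1=(l+\mathrm{id}_{\overline{L}})+_e\widetilde{l}:D\to G$. Then $G\xleftarrow{l_1}D\xleftarrow{d}K$ is the pushback (final pullback complement) of $G\xleftarrow{m}L\xleftarrow{l}K$ in $\mathbf{Gr}$. In particular, $\vec{\widetilde{K}}(n_D,p_D)\cong\vec{\widetilde{L}}(l_1(n_D),l_1(p_D))$ for all nodes $n_D,p_D$ of $D$.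
   Context: A graph $X$ (directed multigraph) consists of a set of nodes $|X|$, a set of edges $\vec{X}$, and source and target functions $\vec X\to|X|$; $\vec X(n,p)$ denotes the set of edges from $n$ to $p$. A morphism $f:X\to Y$ consists of functions on nodes and on edges preserving source and target; this gives the category $\mathbf{Gr}$. The sum $X_1+X_2$ is the disjoint union of graphs. For graphs $X,E$ with $|E|\subseteq|X|$, the edge-sum $X+_eE$ has nodes $|X|$, edges $\vec X+\vec E$, and source/target induced from $X$ and $E$. Sums and edge-sums of morphisms are defined piecewise. If $X$ is a subgraph of $Y$, then $Y=(X+\overline{X})+_e\widetilde{X}$, where $\overline{X}$ is the subgraph of $Y$ generated by the nodes of $Y$ not in $X$ (those nodes and all edges of $Y$ between them), and $\widetilde{X}$ is the subgraph generated by the edges of $Y$ that are neither in $X$ nor in $\overline{X}$. $G\xleftarrow{l_1}D\xleftarrow{d}K$ is a pullback complement of $G\xleftarrow{m}L\xleftarrow{l}K$ if $L\xleftarrow{l}K\xrightarrow{d}D$ is a pullback of $L\xrightarrow{m}G\xleftarrow{l_1}D$. The pushback of $G\xleftarrow{m}L\xleftarrow{l}K$ is its final pullback complement: a pullback complement $G\xleftarrow{l_1}D\xleftarrow{d}K$ such that for every pullback complement $G\xleftarrow{l_1'}D'\xleftarrow{d'}K$ there is a unique $\delta:D'\to D$ with $\delta\circ d'=d$ and $l_1\circ\delta=l_1'$. -}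

module Defs where

open import Data.Sum using (_⊎_; inj₁; inj₂; [_,_]′) renaming (map to ⊎-map)
open import Data.Product using (Σ; _×_; _,_; proj₁; proj₂)
open import Data.Empty using (⊥)
open import Relation.Nullary using (¬_)
open import Relation.Binary.PropositionalEquality using (_≡_; refl; cong; trans)
open import Function using (id; _∘_)
open import Function.Bundles using (_↔_)

record Graph : Set₁ where
  field
    Node : Set
    Edge : Set
    src  : Edge → Node
    tgt  : Edge → Node
open Graph public

Edges : (X : Graph) → Node X → Node X → Set
Edges X n p = Σ (Edge X) λ e → (src X e ≡ n) × (tgt X e ≡ p)

record Hom (X Y : Graph) : Set where
  field
    fN   : Node X → Node Y
    fE   : Edge X → Edge Y
    fsrc : ∀ e → src Y (fE e) ≡ fN (src X e)
    ftgt : ∀ e → tgt Y (fE e) ≡ fN (tgt X e)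
open Hom public

idH : (X : Graph) → Hom X X
idH X = record { fN = id ; fE = id ; fsrc = λ _ → refl ; ftgt = λ _ → refl }

_∘H_ : {X Y Z : Graph} → Hom Y Z → Hom X Y → Hom X Z
_∘H_ {X} {Y} {Z} g f = record
  { fN = fN g ∘ fN f ; fE = fE g ∘ fE f
  ; fsrc = λ e → trans (fsrc g (fE f e)) (cong (fN g) (fsrc f e))
  ; ftgt = λ e → trans (ftgt g (fE f e)) (cong (fN g) (ftgt f e)) }

_≈H_ : {X Y : Graph} → Hom X Y → Hom X Y → Set
f ≈H g = (∀ n → fN f n ≡ fN g n) × (∀ e → fE f e ≡ fE g e)

IsPullback : {A B B' C : Graph} → Hom A B → Hom A B' → Hom B C → Hom B' C → Set₁
IsPullback {A} {B} {B'} {C} f g h k =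
  ((h ∘H f) ≈H (k ∘H g)) ×
  (∀ (Q : Graph) (p : Hom Q B) (q : Hom Q B') → (h ∘H p) ≈H (k ∘H q) →
     Σ (Hom Q A) λ u → ((f ∘H u) ≈H p × (g ∘H u) ≈H q) ×
       (∀ (u' : Hom Q A) → (f ∘H u') ≈H p → (g ∘H u') ≈H q → u' ≈H u))

IsPullbackComplement : {K L G D : Graph} →
  Hom L G → Hom K L → Hom D G → Hom K D → Set₁
IsPullbackComplement m l l1 d = IsPullback l d m l1

IsPushback : {K L G D : Graph} →
  Hom L G → Hom K L → Hom D G → Hom K D → Set₁
IsPushback {K} {L} {G} {D} m l l1 d =
  IsPullbackComplement m l l1 d ×
  (∀ (D' : Graph) (l1' : Hom D' G) (d' : Hom K D') →
     IsPullbackComplement m l l1' d' →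
     Σ (Hom D' D) λ δ → ((δ ∘H d') ≈H d × (l1 ∘H δ) ≈H l1') ×
       (∀ (δ' : Hom D' D) → (δ' ∘H d') ≈H d → (l1 ∘H δ') ≈H l1' → δ' ≈H δ))

_⊕_ : Graph → Graph → Graph
X ⊕ Y = record
  { Node = Node X ⊎ Node Y ; Edge = Edge X ⊎ Edge Y
  ; src = ⊎-map (src X) (src Y) ; tgt = ⊎-map (tgt X) (tgt Y) }

_⊕H_ : {X X' Y Y' : Graph} → Hom X X' → Hom Y Y' → Hom (X ⊕ Y) (X' ⊕ Y')
f ⊕H g = record
  { fN = ⊎-map (fN f) (fN g) ; fE = ⊎-map (fE f) (fE g)
  ; fsrc = λ { (inj₁ e) → cong inj₁ (fsrc f e) ; (inj₂ e) → cong inj₂ (fsrc g e) }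
  ; ftgt = λ { (inj₁ e) → cong inj₁ (ftgt f e) ; (inj₂ e) → cong inj₂ (ftgt g e) } }

-- a graph E whose nodes are (a subset of) the set N: given by its edges
-- together with source and target in N
record EdgesOver (N : Set) : Set₁ where
  field
    EEdge : Set
    esrc  : EEdge → N
    etgt  : EEdge → N
open EdgesOver public

_+e_ : (X : Graph) → EdgesOver (Node X) → Graph
X +e E = record
  { Node = Node X ; Edge = Edge X ⊎ EEdge E
  ; src = [ src X , esrc E ]′ ; tgt = [ tgt X , etgt E ]′ }

record EHom {N M : Set} (φ : N → M) (E : EdgesOver N) (F : EdgesOver M) : Set where
  field
    eE   : EEdge E → EEdge F
    esrc-pres : ∀ e → esrc F (eE e) ≡ φ (esrc E e)
    etgt-pres : ∀ e → etgt F (eE e) ≡ φ (etgt E e)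
open EHom public

_+eH_ : {X Y : Graph} {E : EdgesOver (Node X)} {F : EdgesOver (Node Y)} →
  (f : Hom X Y) → EHom (fN f) E F → Hom (X +e E) (Y +e F)
f +eH g = record
  { fN = fN f ; fE = ⊎-map (fE f) (eE g)
  ; fsrc = λ { (inj₁ e) → fsrc f e ; (inj₂ e) → esrc-pres g e }
  ; ftgt = λ { (inj₁ e) → ftgt f e ; (inj₂ e) → etgt-pres g e } }

incl : (X Y : Graph) (E : EdgesOver (Node X ⊎ Node Y)) → Hom X ((X ⊕ Y) +e E)
incl X Y E = record
  { fN = inj₁ ; fE = λ e → inj₁ (inj₁ e) ; fsrc = λ _ → refl ; ftgt = λ _ → refl }

module Construction (K L Lbar : Graph) (l : Hom K L)
                    (Ltilde : EdgesOver (Node L ⊎ Node Lbar)) where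

  G : Graph
  G = (L ⊕ Lbar) +e Ltilde

  m : Hom L G
  m = incl L Lbar Ltilde

  l+id : Hom (K ⊕ Lbar) (L ⊕ Lbar)
  l+id = l ⊕H idH Lbar

  l1N : Node K ⊎ Node Lbar → Node L ⊎ Node Lbar
  l1N = fN l+id

  Ktilde : EdgesOver (Node K ⊎ Node Lbar)
  Ktilde = record
    { EEdge = Σ (EEdge Ltilde) λ e → Σ (Node K ⊎ Node Lbar) λ n →
                Σ (Node K ⊎ Node Lbar) λ p →
                  (esrc Ltilde e ≡ l1N n) × (etgt Ltilde e ≡ l1N p)
    ; esrc = λ x → proj₁ (proj₂ x)
    ; etgt = λ x → proj₁ (proj₂ (proj₂ x)) }

  ltilde : EHom l1N Ktilde Ltilde
  ltilde = record
    { eE = proj₁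
    ; esrc-pres = λ x → proj₁ (proj₂ (proj₂ (proj₂ x)))
    ; etgt-pres = λ x → proj₂ (proj₂ (proj₂ (proj₂ x))) }

  D : Graph
  D = (K ⊕ Lbar) +e Ktilde

  d : Hom K D
  d = incl K Lbar Ktilde

  l1 : Hom D G
  l1 = l+id +eH ltilde

  KtildeEdges : Node D → Node D → Set
  KtildeEdges n p = Σ (EEdge Ktilde) λ e → (esrc Ktilde e ≡ n) × (etgt Ktilde e ≡ p)

  LtildeEdges : Node G → Node G → Set
  LtildeEdges n p = Σ (EEdge Ltilde) λ e → (esrc Ltilde e ≡ n) × (etgt Ltilde e ≡ p)

-- Ltilde is the part of the decomposition G = (L + Lbar) +_e Ltilde:
-- no edge of Ltilde has both endpoints in Lbar (those belong to Lbar)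
IsComplementEdges : (L Lbar : Graph) → EdgesOver (Node L ⊎ Node Lbar) → Set
IsComplementEdges L Lbar Ltilde =
  ∀ e → ¬ (Σ (Node Lbar) λ a → Σ (Node Lbar) λ b →
             (esrc Ltilde e ≡ inj₂ a) × (etgt Ltilde e ≡ inj₂ b))

-- Nodes and edges of a graph X are morphisms into X from the point
-- graph and from the arrow graph.  Probing a pullback square with these two
-- graphs shows that its apex has, up to unique choice, exactly the nodes and
-- edges of the set-theoretic pullbacks.  Hence any pullback complement D' of
-- G <-m- L <-l- K maps to D: a node or edge of D' lying over L is lifted to
-- K, one lying over Lbar is kept, and an edge e lying over Ltilde goes to the
-- edge (e, n, p) of Ktilde determined by its endpoints.  Uniqueness holds
-- because l1 reflects Lbar and determines Ktilde edges from their endpoints.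
--
-- The theorem
-- combines (3), (4) and (5).
module Submission where

open import Defs
open import Data.Product using (_×_; Σ; _,_; proj₁; proj₂)
open import Data.Sum using (_⊎_; inj₁; inj₂)
open import Data.Sum.Properties using (inj₁-injective; inj₂-injective)
open import Data.Unit using (⊤; tt)
open import Data.Empty using (⊥)
open import Function.Bundles using (_↔_; mk↔ₛ′)
open import Relation.Binary.PropositionalEquality
  using (_≡_; refl; sym; trans; cong; cong₂)
open import Axiom.UniquenessOfIdentityProofs.WithK using (uip)

≈H-refl : {X Y : Graph} (f : Hom X Y) → f ≈H f
≈H-refl f = (λ _ → refl) , (λ _ → refl)

≈H-sym : {X Y : Graph} {f g : Hom X Y} → f ≈H g → g ≈H f
≈H-sym (eqN , eqE) = (λ n → sym (eqN n)) , (λ e → sym (eqE e))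

Point : Graph
Point = record { Node = ⊤ ; Edge = ⊥ ; src = λ () ; tgt = λ () }

pointAt : (X : Graph) → Node X → Hom Point X
pointAt X n = record { fN = λ _ → n ; fE = λ () ; fsrc = λ () ; ftgt = λ () }

Arrow : Graph
Arrow = record { Node = ⊤ ⊎ ⊤ ; Edge = ⊤ ; src = λ _ → inj₁ tt ; tgt = λ _ → inj₂ tt }

arrowAt : (X : Graph) → Edge X → Hom Arrow X
arrowAt X e = record { fN = λ { (inj₁ _) → src X e ; (inj₂ _) → tgt X e }
                     ; fE = λ _ → e ; fsrc = λ _ → refl ; ftgt = λ _ → refl }

-- Two edges with the same image in C give equal probes into C: the image
-- of the edge determines the images of its endpoints.
arrowsAgree : {A B C : Graph} (f : Hom A C) (g : Hom B C) {a : Edge A} {b : Edge B} →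
  fE f a ≡ fE g b → (f ∘H arrowAt A a) ≈H (g ∘H arrowAt B b)
arrowsAgree {C = C} f g {a} {b} eq =
  (λ { (inj₁ _) → trans (sym (fsrc f a)) (trans (cong (src C) eq) (fsrc g b))
     ; (inj₂ _) → trans (sym (ftgt f a)) (trans (cong (tgt C) eq) (ftgt g b)) })
  , (λ _ → eq)

module PullbackProbes {A B B' C : Graph} {f : Hom A B} {g : Hom A B'}
                      {h : Hom B C} {k : Hom B' C} (pb : IsPullback f g h k) where

  jointlyMonic : {Q : Graph} (u v : Hom Q A) →
    (f ∘H u) ≈H (f ∘H v) → (g ∘H u) ≈H (g ∘H v) → u ≈H v
  jointlyMonic {Q} u v fuv guv =
    (λ n → trans (proj₁ u≈w n) (sym (proj₁ v≈w n))) ,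
    (λ e → trans (proj₂ u≈w e) (sym (proj₂ v≈w e)))
    where
    commutes : (h ∘H (f ∘H u)) ≈H (k ∘H (g ∘H u))
    commutes = (λ n → proj₁ (proj₁ pb) (fN u n)) , (λ e → proj₂ (proj₁ pb) (fE u e))
    w : Hom Q A
    w = proj₁ (proj₂ pb Q (f ∘H u) (g ∘H u) commutes)
    unique : ∀ (w' : Hom Q A) → (f ∘H w') ≈H (f ∘H u) → (g ∘H w') ≈H (g ∘H u) → w' ≈H w
    unique = proj₂ (proj₂ (proj₂ pb Q (f ∘H u) (g ∘H u) commutes))
    u≈w : u ≈H w
    u≈w = unique u (≈H-refl (f ∘H u)) (≈H-refl (g ∘H u))
    v≈w : v ≈H w
    v≈w = unique v (≈H-sym {f = f ∘H u} {g = f ∘H v} fuv) (≈H-sym {f = g ∘H u} {g = g ∘H v} guv)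

  liftNode : (b : Node B) (b' : Node B') → fN h b ≡ fN k b' →
    Σ (Node A) λ a → (fN f a ≡ b) × (fN g a ≡ b')
  liftNode b b' eq with proj₂ pb Point (pointAt B b) (pointAt B' b') ((λ _ → eq) , (λ ()))
  ... | u , (fu , gu) , _ = fN u tt , proj₁ fu tt , proj₁ gu tt

  liftEdge : (e : Edge B) (e' : Edge B') → fE h e ≡ fE k e' →
    Σ (Edge A) λ a → (fE f a ≡ e) × (fE g a ≡ e')
  liftEdge e e' eq with proj₂ pb Arrow (arrowAt B e) (arrowAt B' e') (arrowsAgree h k eq)
  ... | u , (fu , gu) , _ = fE u tt , proj₂ fu tt , proj₂ gu tt

  nodeUnique : (a₁ a₂ : Node A) → fN f a₁ ≡ fN f a₂ → fN g a₁ ≡ fN g a₂ → a₁ ≡ a₂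
  nodeUnique a₁ a₂ eqf eqg =
    proj₁ (jointlyMonic (pointAt A a₁) (pointAt A a₂)
                        ((λ _ → eqf) , (λ ())) ((λ _ → eqg) , (λ ()))) tt

  edgeUnique : (a₁ a₂ : Edge A) → fE f a₁ ≡ fE f a₂ → fE g a₁ ≡ fE g a₂ → a₁ ≡ a₂
  edgeUnique a₁ a₂ eqf eqg =
    proj₂ (jointlyMonic (arrowAt A a₁) (arrowAt A a₂)
                        (arrowsAgree f f eqf) (arrowsAgree g g eqg)) tt

module Proof (K L Lbar : Graph) (l : Hom K L)
             (Ltilde : EdgesOver (Node L ⊎ Node Lbar)) where
  open Construction K L Lbar l Ltilde

  nodeOverL : (y : Node D) {a : Node L} → inj₁ a ≡ fN l1 y →
    Σ (Node K) λ x → (inj₁ x ≡ y) × (fN l x ≡ a)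
  nodeOverL (inj₁ x) eq = x , refl , sym (inj₁-injective eq)
  nodeOverL (inj₂ _) ()

  edgeOverL : (z : Edge D) {a : Edge L} → inj₁ (inj₁ a) ≡ fE l1 z →
    Σ (Edge K) λ x → (inj₁ (inj₁ x) ≡ z) × (fE l x ≡ a)
  edgeOverL (inj₁ (inj₁ x)) eq = x , refl , sym (inj₁-injective (inj₁-injective eq))
  edgeOverL (inj₁ (inj₂ _)) ()
  edgeOverL (inj₂ _) ()

  nodeOverLbar : (y : Node D) {b : Node Lbar} → fN l1 y ≡ inj₂ b → y ≡ inj₂ b
  nodeOverLbar (inj₁ _) ()
  nodeOverLbar (inj₂ _) eq = cong inj₂ (inj₂-injective eq)

  edgeOverLbar : (z : Edge D) {b : Edge Lbar} → fE l1 z ≡ inj₁ (inj₂ b) → z ≡ inj₁ (inj₂ b)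
  edgeOverLbar (inj₁ (inj₁ _)) ()
  edgeOverLbar (inj₁ (inj₂ _)) eq = cong (λ w → inj₁ (inj₂ w)) (inj₂-injective (inj₁-injective eq))
  edgeOverLbar (inj₂ _) ()

  edgeOverLtilde : (z : Edge D) (e : EEdge Ltilde) (n p : Node D)
    (s : esrc Ltilde e ≡ l1N n) (t : etgt Ltilde e ≡ l1N p) →
    fE l1 z ≡ inj₂ e → src D z ≡ n → tgt D z ≡ p → z ≡ inj₂ (e , n , p , s , t)
  edgeOverLtilde (inj₁ (inj₁ _)) _ _ _ _ _ ()
  edgeOverLtilde (inj₁ (inj₂ _)) _ _ _ _ _ ()
  edgeOverLtilde (inj₂ (_ , _ , _ , s' , t')) _ _ _ s t refl refl refl =
    cong₂ (λ s″ t″ → inj₂ (_ , _ , _ , s″ , t″)) (uip s' s) (uip t' t)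

  isPullbackComplement : IsPullbackComplement m l l1 d
  isPullbackComplement = ((λ _ → refl) , (λ _ → refl)) , mediate
    where
    mediate : ∀ (Q : Graph) (p : Hom Q L) (q : Hom Q D) → (m ∘H p) ≈H (l1 ∘H q) →
      Σ (Hom Q K) λ u → ((l ∘H u) ≈H p × (d ∘H u) ≈H q) ×
        (∀ (u' : Hom Q K) → (l ∘H u') ≈H p → (d ∘H u') ≈H q → u' ≈H u)
    mediate Q p q (eqN , eqE) = u , ((lu , du) , unique)
      where
      liftN : (n : Node Q) → Σ (Node K) λ x → (inj₁ x ≡ fN q n) × (fN l x ≡ fN p n)
      liftN n = nodeOverL (fN q n) (eqN n)
      liftE : (e : Edge Q) → Σ (Edge K) λ x → (inj₁ (inj₁ x) ≡ fE q e) × (fE l x ≡ fE p e)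
      liftE e = edgeOverL (fE q e) (eqE e)
      u : Hom Q K
      u = record
        { fN = λ n → proj₁ (liftN n) ; fE = λ e → proj₁ (liftE e)
        ; fsrc = λ e → inj₁-injective
            (trans (cong (src D) (proj₁ (proj₂ (liftE e))))
                   (trans (fsrc q e) (sym (proj₁ (proj₂ (liftN (src Q e)))))))
        ; ftgt = λ e → inj₁-injective
            (trans (cong (tgt D) (proj₁ (proj₂ (liftE e))))
                   (trans (ftgt q e) (sym (proj₁ (proj₂ (liftN (tgt Q e))))))) }
      lu : (l ∘H u) ≈H p
      lu = (λ n → proj₂ (proj₂ (liftN n))) , (λ e → proj₂ (proj₂ (liftE e)))
      du : (d ∘H u) ≈H q
      du = (λ n → proj₁ (proj₂ (liftN n))) , (λ e → proj₁ (proj₂ (liftE e)))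
      unique : ∀ (u' : Hom Q K) → (l ∘H u') ≈H p → (d ∘H u') ≈H q → u' ≈H u
      unique u' _ (du'N , du'E) =
        (λ n → inj₁-injective (trans (du'N n) (sym (proj₁ (proj₂ (liftN n)))))) ,
        (λ e → inj₁-injective (inj₁-injective (trans (du'E e) (sym (proj₁ (proj₂ (liftE e)))))))

  module Finality (D' : Graph) (l1' : Hom D' G) (d' : Hom K D')
                  (pc : IsPullbackComplement m l l1' d') where
    open PullbackProbes {f = l} {g = d'} {h = m} {k = l1'} pc

    -- The image of a node n' of D', given y = l1' n' (so that we may case on y).
    mediateNode : (n' : Node D') (y : Node G) → y ≡ fN l1' n' → Node D
    mediateNode n' (inj₁ a) eq = inj₁ (proj₁ (liftNode a n' eq))
    mediateNode n' (inj₂ b) _  = inj₂ b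

    δN : Node D' → Node D
    δN n' = mediateNode n' _ refl

    mediateNode-l1 : ∀ n' y eq → l1N (mediateNode n' y eq) ≡ y
    mediateNode-l1 n' (inj₁ a) eq = cong inj₁ (proj₁ (proj₂ (liftNode a n' eq)))
    mediateNode-l1 n' (inj₂ b) _  = refl

    δN-l1 : ∀ n' → l1N (δN n') ≡ fN l1' n'
    δN-l1 n' = mediateNode-l1 n' _ refl

    mediateNode-d : ∀ x y eq → mediateNode (fN d' x) y eq ≡ inj₁ x
    mediateNode-d x (inj₁ a) eq =
      cong inj₁ (nodeUnique (proj₁ lift) x
        (trans (proj₁ (proj₂ lift)) (inj₁-injective (trans eq (sym (proj₁ (proj₁ pc) x)))))
        (proj₂ (proj₂ lift)))
      where
      lift : Σ (Node K) λ k → (fN l k ≡ a) × (fN d' k ≡ fN d' x)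
      lift = liftNode a (fN d' x) eq
    mediateNode-d x (inj₂ b) eq with trans eq (sym (proj₁ (proj₁ pc) x))
    ... | ()

    δN-d : ∀ x → δN (fN d' x) ≡ inj₁ x
    δN-d x = mediateNode-d x _ refl

    mediateEdge : (z : Edge D') (y : Edge G) → y ≡ fE l1' z → Edge D
    mediateEdge z (inj₁ (inj₁ a)) eq = inj₁ (inj₁ (proj₁ (liftEdge a z eq)))
    mediateEdge z (inj₁ (inj₂ b)) _  = inj₁ (inj₂ b)
    mediateEdge z (inj₂ e) eq = inj₂ (e , δN (src D' z) , δN (tgt D' z)
      , trans (cong (src G) eq) (trans (fsrc l1' z) (sym (δN-l1 _)))
      , trans (cong (tgt G) eq) (trans (ftgt l1' z) (sym (δN-l1 _))))

    -- An edge of D' over L comes from K, so its endpoints are sent into K.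
    mediateEdge-src : ∀ z y eq → src D (mediateEdge z y eq) ≡ δN (src D' z)
    mediateEdge-src z (inj₁ (inj₁ a)) eq =
      sym (trans (cong δN (trans (cong (src D') (sym (proj₂ (proj₂ lift)))) (fsrc d' (proj₁ lift))))
                 (δN-d _))
      where
      lift : Σ (Edge K) λ k → (fE l k ≡ a) × (fE d' k ≡ z)
      lift = liftEdge a z eq
    mediateEdge-src z (inj₁ (inj₂ b)) eq =
      sym (nodeOverLbar (δN (src D' z))
             (trans (δN-l1 _) (trans (sym (fsrc l1' z)) (cong (src G) (sym eq)))))
    mediateEdge-src z (inj₂ e) _ = refl

    mediateEdge-tgt : ∀ z y eq → tgt D (mediateEdge z y eq) ≡ δN (tgt D' z)
    mediateEdge-tgt z (inj₁ (inj₁ a)) eq =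
      sym (trans (cong δN (trans (cong (tgt D') (sym (proj₂ (proj₂ lift)))) (ftgt d' (proj₁ lift))))
                 (δN-d _))
      where
      lift : Σ (Edge K) λ k → (fE l k ≡ a) × (fE d' k ≡ z)
      lift = liftEdge a z eq
    mediateEdge-tgt z (inj₁ (inj₂ b)) eq =
      sym (nodeOverLbar (δN (tgt D' z))
             (trans (δN-l1 _) (trans (sym (ftgt l1' z)) (cong (tgt G) (sym eq)))))
    mediateEdge-tgt z (inj₂ e) _ = refl

    δ : Hom D' D
    δ = record { fN = δN ; fE = λ z → mediateEdge z _ refl
               ; fsrc = λ z → mediateEdge-src z _ refl
               ; ftgt = λ z → mediateEdge-tgt z _ refl }

    mediateEdge-d : ∀ x y eq → mediateEdge (fE d' x) y eq ≡ inj₁ (inj₁ x)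
    mediateEdge-d x (inj₁ (inj₁ a)) eq =
      cong (λ w → inj₁ (inj₁ w)) (edgeUnique (proj₁ lift) x
        (trans (proj₁ (proj₂ lift))
               (inj₁-injective (inj₁-injective (trans eq (sym (proj₂ (proj₁ pc) x))))))
        (proj₂ (proj₂ lift)))
      where
      lift : Σ (Edge K) λ k → (fE l k ≡ a) × (fE d' k ≡ fE d' x)
      lift = liftEdge a (fE d' x) eq
    mediateEdge-d x (inj₁ (inj₂ b)) eq with trans eq (sym (proj₂ (proj₁ pc) x))
    ... | ()
    mediateEdge-d x (inj₂ e) eq with trans eq (sym (proj₂ (proj₁ pc) x))
    ... | ()

    mediateEdge-l1 : ∀ z y eq → fE l1 (mediateEdge z y eq) ≡ y
    mediateEdge-l1 z (inj₁ (inj₁ a)) eq =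
      cong (λ w → inj₁ (inj₁ w)) (proj₁ (proj₂ (liftEdge a z eq)))
    mediateEdge-l1 z (inj₁ (inj₂ b)) _ = refl
    mediateEdge-l1 z (inj₂ e) _ = refl

    δ-d : (δ ∘H d') ≈H d
    δ-d = δN-d , (λ x → mediateEdge-d x _ refl)

    δ-l1 : (l1 ∘H δ) ≈H l1'
    δ-l1 = δN-l1 , (λ z → mediateEdge-l1 z _ refl)

    -- Any δ' with the same two properties agrees with δ: over L by the
    -- pullback property of K, elsewhere because l1 reflects the rest of G.
    module Uniqueness (δ' : Hom D' D) (δ'-d : (δ' ∘H d') ≈H d) (δ'-l1 : (l1 ∘H δ') ≈H l1') where
      agreeNode : ∀ n' y eq → fN δ' n' ≡ mediateNode n' y eq
      agreeNode n' (inj₁ a) eq =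
        trans (cong (fN δ') (sym (proj₂ (proj₂ lift)))) (proj₁ δ'-d (proj₁ lift))
        where
        lift : Σ (Node K) λ k → (fN l k ≡ a) × (fN d' k ≡ n')
        lift = liftNode a n' eq
      agreeNode n' (inj₂ b) eq = nodeOverLbar _ (trans (proj₁ δ'-l1 n') (sym eq))

      agreeEdge : ∀ z y eq → fE δ' z ≡ mediateEdge z y eq
      agreeEdge z (inj₁ (inj₁ a)) eq =
        trans (cong (fE δ') (sym (proj₂ (proj₂ lift)))) (proj₂ δ'-d (proj₁ lift))
        where
        lift : Σ (Edge K) λ k → (fE l k ≡ a) × (fE d' k ≡ z)
        lift = liftEdge a z eq
      agreeEdge z (inj₁ (inj₂ b)) eq = edgeOverLbar _ (trans (proj₂ δ'-l1 z) (sym eq))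
      agreeEdge z (inj₂ e) eq = edgeOverLtilde _ e _ _ _ _ (trans (proj₂ δ'-l1 z) (sym eq))
        (trans (fsrc δ' z) (agreeNode (src D' z) _ refl))
        (trans (ftgt δ' z) (agreeNode (tgt D' z) _ refl))

      δ'≈δ : δ' ≈H δ
      δ'≈δ = (λ n' → agreeNode n' _ refl) , (λ z → agreeEdge z _ refl)

    final : Σ (Hom D' D) λ δ → ((δ ∘H d') ≈H d × (l1 ∘H δ) ≈H l1') ×
      (∀ (δ' : Hom D' D) → (δ' ∘H d') ≈H d → (l1 ∘H δ') ≈H l1' → δ' ≈H δ)
    final = δ , (δ-d , δ-l1) , (λ δ' δ'-d δ'-l1 → Uniqueness.δ'≈δ δ' δ'-d δ'-l1)

  -- (5) Ktilde has, between n and p, exactly the Ltilde edges between l1 n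
  -- and l1 p: an edge (e, n, p) is the edge e together with its endpoints.
  ktildeEdges≅ : ∀ (n p : Node D) → KtildeEdges n p ↔ LtildeEdges (fN l1 n) (fN l1 p)
  ktildeEdges≅ n p = mk↔ₛ′ to from to∘from from∘to
    where
    to : KtildeEdges n p → LtildeEdges (fN l1 n) (fN l1 p)
    to ((e , _ , _ , s , t) , refl , refl) = e , s , t
    from : LtildeEdges (fN l1 n) (fN l1 p) → KtildeEdges n p
    from (e , s , t) = (e , n , p , s , t) , refl , refl
    to∘from : ∀ y → to (from y) ≡ y
    to∘from _ = refl
    from∘to : ∀ x → from (to x) ≡ x
    from∘to ((_ , _ , _ , _ , _) , refl , refl) = refl

proposition2p7 : (K L Lbar : Graph) (l : Hom K L)
    (Ltilde : EdgesOver (Node L ⊎ Node Lbar)) →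
    IsComplementEdges L Lbar Ltilde →
    let open Construction K L Lbar l Ltilde in
    IsPushback m l l1 d ×
    (∀ (n p : Node D) → KtildeEdges n p ↔ LtildeEdges (fN l1 n) (fN l1 p))
proposition2p7 K L Lbar l Ltilde _ =
  (isPullbackComplement , (λ D' l1' d' pc → Finality.final D' l1' d' pc)) , ktildeEdges≅
  where open Proof K L Lbar l Ltilde
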